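{- (a) For $n\ge 0$: $a(n)=a(n+1)$ if and only if $n\in\{\lfloor \varphi^2 k\rfloor-1 : k\ge 1\}$. (b) For $n\ge0$: $a(n)\ne a(n+1)$ if and only if $n\in\{\lfloor \varphi k+1/\varphi\rfloor : k\ge 0\}$. (c) For $n\ge 1$: $a(n)\notin\{a(n-1),a(n+1)\}$ if and only if $n\in\{\lfloor \varphi\lfloor\varphi^2 k\rfloor\rfloor : k\ge 1\}$.
   Context: $\varphi=(1+\sqrt5)/2$. Fibonacci numbers: $F_0=0$, $F_1=1$, $F_n=F_{n-1}+F_{n-2}$. The sequence $(a(n))_{n\geq 0}$ (OEIS A105774) is defined by $a(n)=n$ for $n\le 1$, and $a(n)=F_{j+1}-a(n-F_j)$ if $F_j<n\le F_{j+1}$ with $j\ge 2$. -}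

module Defs where

open import Data.Nat using (ℕ; zero; suc; _+_; _*_; _∸_; _/_; _≤?_)
open import Data.Bool using (if_then_else_)
open import Relation.Nullary.Decidable using (⌊_⌋)

fib : ℕ → ℕ
fib zero = zero
fib (suc zero) = suc zero
fib (suc (suc n)) = fib (suc n) + fib n

isqrt : ℕ → ℕ
isqrt zero = zero
isqrt (suc n) =
  if ⌊ suc (isqrt n) * suc (isqrt n) ≤? suc n ⌋ then suc (isqrt n) else isqrt n

-- ⌊ b √5 ⌋ = ⌊ √(5 b²) ⌋
floorSqrt5 : ℕ → ℕ
floorSqrt5 b = isqrt (5 * (b * b))

-- φ = (1 + √5)/2.  For integer a and real x, ⌊(a + x)/2⌋ = ⌊(a + ⌊x⌋)/2⌋.
-- ⌊ φ k ⌋ = ⌊ (k + k√5)/2 ⌋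
floorPhi : ℕ → ℕ
floorPhi k = (k + floorSqrt5 k) / 2

-- φ² = (3 + √5)/2 ;  ⌊ φ² k ⌋ = ⌊ (3k + k√5)/2 ⌋
floorPhi2 : ℕ → ℕ
floorPhi2 k = (3 * k + floorSqrt5 k) / 2

-- 1/φ = (√5 - 1)/2 ; φ k + 1/φ = ((k - 1) + (k+1)√5)/2, and
-- (k - 1) + ⌊(k+1)√5⌋ ≥ 1, so truncated subtraction is exact here.
floorPhiPlusInvPhi : ℕ → ℕ
floorPhiPlusInvPhi k = (k + floorSqrt5 (suc k) ∸ 1) / 2

findJ : ℕ → ℕ → ℕ → ℕ
findJ zero j n = j
findJ (suc fuel) j n = if ⌊ n ≤? fib (suc j) ⌋ then j else findJ fuel (suc j) n

aFuel : ℕ → ℕ → ℕ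
aFuel zero n = n
aFuel (suc fuel) zero = zero
aFuel (suc fuel) (suc zero) = suc zero
aFuel (suc fuel) (suc (suc m)) =
  let n = suc (suc m)
      j = findJ n 2 n
  in fib (suc j) ∸ aFuel fuel (n ∸ fib j)

-- A105774: a(n) = n for n ≤ 1, a(n) = F(j+1) - a(n - F j) for F j < n ≤ F(j+1), j ≥ 2
a : ℕ → ℕ
a n = aFuel (suc n) n

-- ⌊ y /φ⌋ = ⌊φ y⌋ − y grows by 0 or 1 at each step; since the intervals (⌊φ q⌋, ⌊φ (q + 1)⌋] have
-- length 1 or 2, it jumps right after the points ⌊φ k⌋ and is flat right after the points
-- ⌊φ² k⌋ = ⌊φ k⌋ + k (complementary Beatty sequences).  The heart of the proof is that a(n) = a(n + 1)
-- iff ⌊(n + 1)/φ⌋ = ⌊(n + 2)/φ⌋.  On a block F_j < n ≤ F_{j+1} the sequence a is the reflection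
-- F_{j+1} − a(n − F_j) of an earlier stretch, while ⌊(F_j + x)/φ⌋ = F_{j−1} + ⌊x/φ⌋ is a translation of
-- one, so flat points correspond by strong induction; at the end of a block both sequences step.
-- Parts (a) and (b) are then the Beatty descriptions, and (c) asks for two consecutive jumps, which
-- happen exactly at ⌊φ q⌋ with ⌊ ·/φ⌋ flat at q, i.e. q = ⌊φ² k⌋.

module Submission where

open import Defs
open import Data.Nat using (ℕ; zero; suc; _+_; _*_; _∸_; _/_; _≤_; _<_; z≤n; s≤s; _≤?_; _<?_; _≤′_; ≤′-refl; ≤′-step)
open import Data.Nat.Properties
open import Data.Nat.DivMod using (m/n≡1+[m∸n]/n)
open import Data.Nat.Induction using (<-rec)
open import Data.Nat.Tactic.RingSolver using (solve-∀)
open import Data.Product using (_×_; _,_; ∃-syntax; proj₁; proj₂)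
open import Data.Sum using (_⊎_; inj₁; inj₂)
open import Data.Empty using (⊥-elim)
open import Relation.Nullary using (¬_; yes; no)
open import Relation.Nullary.Decidable using (from-yes; from-no)
open import Relation.Binary using (tri<; tri≈; tri>)
open import Relation.Binary.PropositionalEquality
open import Function using (_∘_)
open import Function.Bundles using (_⇔_; mk⇔; Equivalence)
open import Function.Properties.Equivalence using () renaming (sym to ⇔-sym; trans to ⇔-trans)

suc-mono-≤⇒mono-≤ : (g : ℕ → ℕ) → (∀ n → g n ≤ g (suc n)) → ∀ {m n} → m ≤ n → g m ≤ g n
suc-mono-≤⇒mono-≤ g g-step {m} m≤n = go (≤⇒≤′ m≤n)
  where
  go : ∀ {n} → m ≤′ n → g m ≤ g n
  go ≤′-refl = ≤-refl
  go (≤′-step m≤′n) = ≤-trans (go m≤′n) (g-step _)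

∃-⇔ : {A : Set} {P Q : A → Set} → (∀ k → P k ⇔ Q k) → (∃[ k ] P k) ⇔ (∃[ k ] Q k)
∃-⇔ P⇔Q = mk⇔ (λ (k , p) → k , Equivalence.to (P⇔Q k) p) (λ (k , q) → k , Equivalence.from (P⇔Q k) q)

×-⇔ʳ : {A B C : Set} → (A → B ⇔ C) → (A × B) ⇔ (A × C)
×-⇔ʳ B⇔C = mk⇔ (λ (x , y) → x , Equivalence.to (B⇔C x) y) (λ (x , z) → x , Equivalence.from (B⇔C x) z)

suc-≡⇔≡-∸1 : ∀ {n x} → 1 ≤ x → (suc n ≡ x) ⇔ (n ≡ x ∸ 1)
suc-≡⇔≡-∸1 {x = suc x} _ = mk⇔ suc-injective (cong suc)

≡-trans-⇔ : {A : Set} {x y z : A} → y ≡ z → (x ≡ y) ⇔ (x ≡ z)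
≡-trans-⇔ y≡z = mk⇔ (λ x≡y → trans x≡y y≡z) (λ x≡z → trans x≡z (sym y≡z))

isqrt-bounds : ∀ n → isqrt n * isqrt n ≤ n × n < suc (isqrt n) * suc (isqrt n)
isqrt-bounds zero = z≤n , s≤s z≤n
isqrt-bounds (suc n) with isqrt-bounds n | suc (isqrt n) * suc (isqrt n) ≤? suc n
... | _ , n<[1+s]² | yes [1+s]²≤1+n = [1+s]²≤1+n , <-≤-trans (s≤s n<[1+s]²) (square-< (isqrt n))
  where
  square-< : ∀ s → suc (suc s * suc s) ≤ suc (suc s) * suc (suc s)
  square-< s = subst (suc (suc s * suc s) ≤_) (expand s) (s≤s (m≤m+n _ _))
    where
    expand : ∀ s → suc (suc s * suc s + suc (suc (s + s))) ≡ suc (suc s) * suc (suc s)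
    expand = solve-∀
... | s²≤n , _ | no [1+s]²≰1+n = m≤n⇒m≤1+n s²≤n , ≰⇒> [1+s]²≰1+n

1≤isqrt : ∀ {n} → 1 ≤ n → 1 ≤ isqrt n
1≤isqrt {n} 1≤n with isqrt n | proj₂ (isqrt-bounds n)
... | suc _ | _ = s≤s z≤n
... | zero | n<1 = ⊥-elim (<⇒≱ n<1 1≤n)

[2+n]/2≡1+n/2 : ∀ n → suc (suc n) / 2 ≡ suc (n / 2)
[2+n]/2≡1+n/2 n = m/n≡1+[m∸n]/n {suc (suc n)} {2} (s≤s (s≤s z≤n))

2*[n/2]≤n : ∀ n → 2 * (n / 2) ≤ n
2*[n/2]≤n zero = z≤n
2*[n/2]≤n (suc zero) = z≤n
2*[n/2]≤n (suc (suc n)) rewrite [2+n]/2≡1+n/2 n | +-suc (n / 2) (n / 2 + 0) = s≤s (s≤s (2*[n/2]≤n n))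

n≤1+2*[n/2] : ∀ n → n ≤ suc (2 * (n / 2))
n≤1+2*[n/2] zero = z≤n
n≤1+2*[n/2] (suc zero) = s≤s z≤n
n≤1+2*[n/2] (suc (suc n)) rewrite [2+n]/2≡1+n/2 n | +-suc (n / 2) (n / 2 + 0) = s≤s (s≤s (n≤1+2*[n/2] n))

[2*k+n]/2≡k+n/2 : ∀ k n → (2 * k + n) / 2 ≡ k + n / 2
[2*k+n]/2≡k+n/2 zero n = refl
[2*k+n]/2≡k+n/2 (suc k) n rewrite +-suc k (k + 0) | [2+n]/2≡1+n/2 (2 * k + n) = cong suc ([2*k+n]/2≡k+n/2 k n)

-- φ is the positive root of x² = x + 1, so for naturals p ≤ φ k iff p² ≤ p k + k².
_≤φ·_ : ℕ → ℕ → Set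
p ≤φ· k = p * p ≤ p * k + k * k

≤-≤φ·-trans : ∀ {p p′ k} → p ≤ p′ → p′ ≤φ· k → p ≤φ· k
≤-≤φ·-trans {p} {p′} {k} p≤p′ p′≤φk with p ≤? k
... | yes p≤k = ≤-trans (*-monoʳ-≤ p p≤k) (m≤m+n _ _)
... | no p≰k = +-cancelʳ-≤ (t * k) (p * p) (p * k + k * k) (begin
    p * p + t * k                  ≤⟨ +-monoʳ-≤ (p * p) tk≤ ⟩
    p * p + (2 * (p * t) + t * t)  ≡⟨ expand p t ⟨
    (p + t) * (p + t)              ≡⟨ cong (λ u → u * u) p+t≡p′ ⟩
    p′ * p′                        ≤⟨ p′≤φk ⟩
    p′ * k + k * k                 ≡⟨ cong (λ u → u * k + k * k) p+t≡p′ ⟨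
    (p + t) * k + k * k            ≡⟨ regroup p t k ⟩
    (p * k + k * k) + t * k        ∎)
  where
  open ≤-Reasoning
  t = p′ ∸ p
  p+t≡p′ : p + t ≡ p′
  p+t≡p′ = m+[n∸m]≡n p≤p′
  tk≤ : t * k ≤ 2 * (p * t) + t * t
  tk≤ = begin
    t * k                   ≤⟨ *-monoʳ-≤ t (<⇒≤ (≰⇒> p≰k)) ⟩
    t * p                   ≡⟨ *-comm t p ⟩
    p * t                   ≤⟨ m≤m+n (p * t) (p * t + 0) ⟩
    2 * (p * t)             ≤⟨ m≤m+n _ _ ⟩
    2 * (p * t) + t * t     ∎
  expand : ∀ p t → (p + t) * (p + t) ≡ p * p + (2 * (p * t) + t * t)
  expand = solve-∀
  regroup : ∀ p t k → (p + t) * k + k * k ≡ (p * k + k * k) + t * k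
  regroup = solve-∀

2*-≤φ·⇔ : ∀ p k → (2 * p) ≤φ· (2 * k) ⇔ p ≤φ· k
2*-≤φ·⇔ p k = mk⇔ (λ h → *-cancelˡ-≤ 4 (subst₂ _≤_ (lhs p) (rhs p k) h))
                      (λ h → subst₂ _≤_ (sym (lhs p)) (sym (rhs p k)) (*-monoʳ-≤ 4 h))
  where
  lhs : ∀ p → 2 * p * (2 * p) ≡ 4 * (p * p)
  lhs = solve-∀
  rhs : ∀ p k → 2 * p * (2 * k) + 2 * k * (2 * k) ≡ 4 * (p * k + k * k)
  rhs = solve-∀

-- φ · 2k = k + √5 k, so comparing t with φ · 2k amounts to comparing t ∸ k with √(5k²).
≤-+√5-⇒≤φ·2* : ∀ {k s t} → s * s ≤ 5 * (k * k) → t ≤ k + s → t ≤φ· (2 * k)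
≤-+√5-⇒≤φ·2* {k} {s} {t} s²≤5k² t≤k+s with t ≤? k
... | yes t≤k = ≤-trans (*-monoʳ-≤ t (≤-trans t≤k (m≤m+n k (k + 0)))) (m≤m+n _ _)
... | no t≰k = subst (_≤φ· (2 * k)) (m+[n∸m]≡n (<⇒≤ (≰⇒> t≰k))) (begin
    (k + d) * (k + d)                       ≡⟨ square k d ⟩
    (k * k + 2 * (k * d)) + d * d           ≤⟨ +-monoʳ-≤ (k * k + 2 * (k * d)) (≤-trans (*-mono-≤ d≤s d≤s) s²≤5k²) ⟩
    (k * k + 2 * (k * d)) + 5 * (k * k)     ≡⟨ square′ k d ⟩
    (k + d) * (2 * k) + 2 * k * (2 * k)     ∎)
  where
  open ≤-Reasoning
  d = t ∸ k
  d≤s : d ≤ s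
  d≤s = subst (d ≤_) (m+n∸m≡n k s) (∸-monoˡ-≤ k t≤k+s)
  square : ∀ k d → (k + d) * (k + d) ≡ (k * k + 2 * (k * d)) + d * d
  square = solve-∀
  square′ : ∀ k d → (k * k + 2 * (k * d)) + 5 * (k * k) ≡ (k + d) * (2 * k) + 2 * k * (2 * k)
  square′ = solve-∀

+√5-≤⇒≰φ·2* : ∀ {k s t} → 5 * (k * k) < s * s → k + s ≤ t → ¬ t ≤φ· (2 * k)
+√5-≤⇒≰φ·2* {k} {s} {t} 5k²<s² k+s≤t = <⇒≱ (subst (λ u → u * (2 * k) + 2 * k * (2 * k) < u * u) (m+[n∸m]≡n (≤-trans (m≤m+n k s) k+s≤t)) (begin-strict
    (k + d) * (2 * k) + 2 * k * (2 * k)     ≡⟨ square′ k d ⟨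
    (k * k + 2 * (k * d)) + 5 * (k * k)     <⟨ +-monoʳ-< (k * k + 2 * (k * d)) (<-≤-trans 5k²<s² (*-mono-≤ s≤d s≤d)) ⟩
    (k * k + 2 * (k * d)) + d * d           ≡⟨ square k d ⟨
    (k + d) * (k + d)                       ∎))
  where
  open ≤-Reasoning
  d = t ∸ k
  s≤d : s ≤ d
  s≤d = subst (_≤ d) (m+n∸m≡n k s) (∸-monoˡ-≤ k k+s≤t)
  square : ∀ k d → (k + d) * (k + d) ≡ (k * k + 2 * (k * d)) + d * d
  square = solve-∀
  square′ : ∀ k d → (k * k + 2 * (k * d)) + 5 * (k * k) ≡ (k + d) * (2 * k) + 2 * k * (2 * k)
  square′ = solve-∀

floorPhi-spec : ∀ k → floorPhi k ≤φ· k × ¬ suc (floorPhi k) ≤φ· k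
floorPhi-spec k = Equivalence.to (2*-≤φ·⇔ p k) (≤-+√5-⇒≤φ·2* {k} {s} (proj₁ s-bounds) (2*[n/2]≤n (k + s)))
                , λ 1+p≤φk → +√5-≤⇒≰φ·2* {k} {suc s} (proj₂ s-bounds) k+1+s≤2+2p (Equivalence.from (2*-≤φ·⇔ (suc p) k) 1+p≤φk)
  where
  s = floorSqrt5 k
  p = floorPhi k
  s-bounds = isqrt-bounds (5 * (k * k))
  k+1+s≤2+2p : k + suc s ≤ 2 * suc p
  k+1+s≤2+2p = subst₂ _≤_ (sym (+-suc k s)) (double-suc p) (s≤s (n≤1+2*[n/2] (k + s)))
    where
    double-suc : ∀ h → suc (suc (2 * h)) ≡ 2 * suc h
    double-suc = solve-∀

-- Kept opaque: isqrt evaluates its recursive call twice per step, so even ⌊φ· 4 ⌋ would not normalise in reasonable time.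
opaque
  ⌊φ·_⌋ : ℕ → ℕ
  ⌊φ· k ⌋ = floorPhi k

  ⌊φ·⌋≡floorPhi : ∀ k → ⌊φ· k ⌋ ≡ floorPhi k
  ⌊φ·⌋≡floorPhi k = refl

⌊φ·⌋-spec : ∀ k → ⌊φ· k ⌋ ≤φ· k × ¬ suc ⌊φ· k ⌋ ≤φ· k
⌊φ·⌋-spec k rewrite ⌊φ·⌋≡floorPhi k = floorPhi-spec k

⌊φ·⌋-greatest : ∀ {p k} → p ≤φ· k → p ≤ ⌊φ· k ⌋
⌊φ·⌋-greatest {p} {k} p≤φk with p ≤? ⌊φ· k ⌋
... | yes p≤ = p≤
... | no p≰ = ⊥-elim (proj₂ (⌊φ·⌋-spec k) (≤-≤φ·-trans (≰⇒> p≰) p≤φk))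

⌊φ·⌋-unique : ∀ {p k} → p ≤φ· k → ¬ suc p ≤φ· k → ⌊φ· k ⌋ ≡ p
⌊φ·⌋-unique {p} {k} p≤φk 1+p≰φk = ≤-antisym ⌊φk⌋≤p (⌊φ·⌋-greatest p≤φk)
  where
  ⌊φk⌋≤p : ⌊φ· k ⌋ ≤ p
  ⌊φk⌋≤p with ⌊φ· k ⌋ ≤? p
  ... | yes ≤p = ≤p
  ... | no ≰p = ⊥-elim (1+p≰φk (≤-≤φ·-trans (≰⇒> ≰p) (proj₁ (⌊φ·⌋-spec k))))

⌊φ·⌋-values : ⌊φ· 0 ⌋ ≡ 0 × ⌊φ· 1 ⌋ ≡ 1 × ⌊φ· 2 ⌋ ≡ 3 × ⌊φ· 3 ⌋ ≡ 4 × ⌊φ· 4 ⌋ ≡ 6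
⌊φ·⌋-values = ⌊φ·⌋-unique {0} {0} z≤n (from-no (1 ≤? 0))
            , ⌊φ·⌋-unique {1} {1} (from-yes (1 ≤? 2)) (from-no (4 ≤? 3))
            , ⌊φ·⌋-unique {3} {2} (from-yes (9 ≤? 10)) (from-no (16 ≤? 12))
            , ⌊φ·⌋-unique {4} {3} (from-yes (16 ≤? 21)) (from-no (25 ≤? 24))
            , ⌊φ·⌋-unique {6} {4} (from-yes (36 ≤? 40)) (from-no (49 ≤? 44))

-- y / q = φ is impossible: a solution with q < y yields the smaller solution (q, y ∸ q).
φ-irrational : ∀ {y q} → y * y ≡ y * q + q * q → y ≡ 0
φ-irrational {y} = descend y ≤-refl
  where
  descend : ∀ fuel {y q} → y ≤ fuel → y * y ≡ y * q + q * q → y ≡ 0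
  descend _ {zero} _ _ = refl
  descend _ {suc y} {zero} _ eq = ⊥-elim (1+n≢0 (trans eq (cong (_+ 0) (*-zeroʳ (suc y)))))
  descend zero {suc y} {suc q} () _
  descend (suc fuel) {y@(suc _)} {q@(suc _)} (s≤s y≤fuel) eq with y ≤? q
  ... | yes y≤q = ⊥-elim (<⇒≱ (m<m+n (y * q) (s≤s z≤n)) (subst (_≤ y * q) eq (*-monoʳ-≤ y y≤q)))
  ... | no y≰q = ⊥-elim (1+n≢0 (descend fuel {q} {r} (≤-trans (≤-pred (≰⇒> y≰q)) y≤fuel) smaller))
    where
    r = y ∸ q
    q+r≡y : q + r ≡ y
    q+r≡y = m+[n∸m]≡n (<⇒≤ (≰⇒> y≰q))
    expand : ∀ q r → (q + r) * (q + r) ≡ (q * q + q * r) + (q * r + r * r)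
    expand = solve-∀
    expand′ : ∀ q r → (q + r) * q + q * q ≡ (q * q + q * r) + q * q
    expand′ = solve-∀
    smaller : q * q ≡ q * r + r * r
    smaller = sym (+-cancelˡ-≡ _ _ _ (begin
      (q * q + q * r) + (q * r + r * r)  ≡⟨ expand q r ⟨
      (q + r) * (q + r)                  ≡⟨ subst (λ u → u * u ≡ u * q + q * q) (sym q+r≡y) eq ⟩
      (q + r) * q + q * q                ≡⟨ expand′ q r ⟩
      (q * q + q * r) + q * q            ∎))
      where open ≡-Reasoning

-- 1/φ = φ - 1
⌊_/φ⌋ : ℕ → ℕ
⌊ y /φ⌋ = ⌊φ· y ⌋ ∸ y

_·φ≤_ : ℕ → ℕ → Set
q ·φ≤ y = q * q + q * y ≤ y * y

n≤⌊φ·n⌋ : ∀ n → n ≤ ⌊φ· n ⌋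
n≤⌊φ·n⌋ n = ⌊φ·⌋-greatest (m≤m+n (n * n) (n * n))

⌊φ·⌋≡+⌊/φ⌋ : ∀ y → ⌊φ· y ⌋ ≡ y + ⌊ y /φ⌋
⌊φ·⌋≡+⌊/φ⌋ y = sym (m+[n∸m]≡n (n≤⌊φ·n⌋ y))

·φ≤⇔+≤φ· : ∀ q y → q ·φ≤ y ⇔ (y + q) ≤φ· y
·φ≤⇔+≤φ· q y = mk⇔ (λ h → subst₂ _≤_ (sym (expand y q)) (sym (expand′ y q)) (+-monoʳ-≤ (y * y + q * y) h))
                        (λ h → +-cancelˡ-≤ (y * y + q * y) _ _ (subst₂ _≤_ (expand y q) (expand′ y q) h))
  where
  expand : ∀ y q → (y + q) * (y + q) ≡ (y * y + q * y) + (q * q + q * y)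
  expand = solve-∀
  expand′ : ∀ y q → (y + q) * y + y * y ≡ (y * y + q * y) + y * y
  expand′ = solve-∀

⌊/φ⌋-spec : ∀ y → ⌊ y /φ⌋ ·φ≤ y × ¬ suc ⌊ y /φ⌋ ·φ≤ y
⌊/φ⌋-spec y = Equivalence.from (·φ≤⇔+≤φ· ⌊ y /φ⌋ y) (subst (_≤φ· y) (⌊φ·⌋≡+⌊/φ⌋ y) (proj₁ (⌊φ·⌋-spec y)))
            , λ h → proj₂ (⌊φ·⌋-spec y) (subst (_≤φ· y) (trans (+-suc y ⌊ y /φ⌋) (cong suc (sym (⌊φ·⌋≡+⌊/φ⌋ y)))) (Equivalence.to (·φ≤⇔+≤φ· (suc ⌊ y /φ⌋) y) h))

⌊/φ⌋-greatest : ∀ {q y} → q ·φ≤ y → q ≤ ⌊ y /φ⌋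
⌊/φ⌋-greatest {q} {y} qφ≤y = subst (_≤ ⌊ y /φ⌋) (m+n∸m≡n y q) (∸-monoˡ-≤ y (⌊φ·⌋-greatest (Equivalence.to (·φ≤⇔+≤φ· q y) qφ≤y)))

·φ≤⇒≤ : ∀ {q y} → q ·φ≤ y → q ≤ y
·φ≤⇒≤ {q} {y} qφ≤y with q ≤? y
... | yes q≤y = q≤y
... | no q≰y = ⊥-elim (<⇒≱ (*-mono-< (≰⇒> q≰y) (≰⇒> q≰y)) (≤-trans (m≤m+n (q * q) (q * y)) qφ≤y))

·φ≤-suc : ∀ {q y} → q ·φ≤ y → q ·φ≤ suc y
·φ≤-suc {q} {y} qφ≤y = subst₂ _≤_ (sym (expand q y)) (sym (expand′ y)) (+-mono-≤ qφ≤y (≤-trans (·φ≤⇒≤ qφ≤y) (m≤m+n y (suc y))))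
  where
  expand : ∀ q y → q * q + q * suc y ≡ (q * q + q * y) + q
  expand = solve-∀
  expand′ : ∀ y → suc y * suc y ≡ y * y + (y + suc y)
  expand′ = solve-∀

⌊/φ⌋-≤-suc : ∀ y → ⌊ y /φ⌋ ≤ ⌊ suc y /φ⌋
⌊/φ⌋-≤-suc y = ⌊/φ⌋-greatest {y = suc y} (·φ≤-suc {⌊ y /φ⌋} {y} (proj₁ (⌊/φ⌋-spec y)))

⌊/φ⌋-mono-≤ : ∀ {y y′} → y ≤ y′ → ⌊ y /φ⌋ ≤ ⌊ y′ /φ⌋
⌊/φ⌋-mono-≤ = suc-mono-≤⇒mono-≤ ⌊_/φ⌋ ⌊/φ⌋-≤-suc

⌊φ·⌋-<-suc : ∀ k → ⌊φ· k ⌋ < ⌊φ· suc k ⌋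
⌊φ·⌋-<-suc k rewrite ⌊φ·⌋≡+⌊/φ⌋ k | ⌊φ·⌋≡+⌊/φ⌋ (suc k) = s≤s (+-monoʳ-≤ k (⌊/φ⌋-≤-suc k))

⌊φ·⌋-mono-≤ : ∀ {k k′} → k ≤ k′ → ⌊φ· k ⌋ ≤ ⌊φ· k′ ⌋
⌊φ·⌋-mono-≤ = suc-mono-≤⇒mono-≤ ⌊φ·_⌋ (λ k → <⇒≤ (⌊φ·⌋-<-suc k))

⌊φ·⌊n/φ⌋⌋<n : ∀ {n} → 1 ≤ n → ⌊φ· ⌊ n /φ⌋ ⌋ < n
⌊φ·⌊n/φ⌋⌋<n {n} 1≤n with ⌊φ· ⌊ n /φ⌋ ⌋ <? n
... | yes <n = <n
... | no ≮n = ⊥-elim (<⇒≱ 1≤n (≤-reflexive (φ-irrational (≤-antisym n≤φq (subst (_≤ n * n) commute (proj₁ (⌊/φ⌋-spec n)))))))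
  where
  q = ⌊ n /φ⌋
  n≤φq : n ≤φ· q
  n≤φq = ≤-≤φ·-trans (≮⇒≥ ≮n) (proj₁ (⌊φ·⌋-spec q))
  commute : q * q + q * n ≡ n * q + q * q
  commute = trans (+-comm (q * q) (q * n)) (cong (_+ q * q) (*-comm q n))

n≤⌊φ·[1+⌊n/φ⌋]⌋ : ∀ n → n ≤ ⌊φ· suc ⌊ n /φ⌋ ⌋
n≤⌊φ·[1+⌊n/φ⌋]⌋ n = ⌊φ·⌋-greatest (subst (n * n ≤_) commute (<⇒≤ (≰⇒> (proj₂ (⌊/φ⌋-spec n)))))
  where
  q = suc ⌊ n /φ⌋
  commute : q * q + q * n ≡ n * q + q * q
  commute = trans (+-comm (q * q) (q * n)) (cong (_+ q * q) (*-comm q n))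

-- The intervals (⌊φ q⌋, ⌊φ (q + 1)⌋] partition the positive integers, and ⌊ y /φ⌋ is the index of the one containing y.
⌊/φ⌋-unique : ∀ {y q} → ⌊φ· q ⌋ < y → y ≤ ⌊φ· suc q ⌋ → ⌊ y /φ⌋ ≡ q
⌊/φ⌋-unique {y} {q} φq<y y≤φ[1+q] with <-cmp q ⌊ y /φ⌋
... | tri≈ _ q≡ _ = sym q≡
... | tri< q< _ _ = ⊥-elim (<-irrefl refl (<-≤-trans (≤-<-trans (⌊φ·⌋-mono-≤ q<) (⌊φ·⌊n/φ⌋⌋<n (≤-<-trans z≤n φq<y))) y≤φ[1+q]))
... | tri> _ _ >q = ⊥-elim (<-irrefl refl (<-≤-trans (≤-<-trans (⌊φ·⌋-mono-≤ >q) φq<y) (n≤⌊φ·[1+⌊n/φ⌋]⌋ y)))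

⌊/φ⌋-suc-≤ : ∀ y → ⌊ suc y /φ⌋ ≤ suc ⌊ y /φ⌋
⌊/φ⌋-suc-≤ y with ⌊ suc y /φ⌋ ≤? suc ⌊ y /φ⌋
... | yes ≤1+ = ≤1+
... | no ≰1+ = ⊥-elim (<⇒≱ (⌊φ·⌊n/φ⌋⌋<n (s≤s z≤n)) (begin
  suc y                           ≤⟨ s≤s (n≤⌊φ·[1+⌊n/φ⌋]⌋ y) ⟩
  suc ⌊φ· suc ⌊ y /φ⌋ ⌋           ≤⟨ ⌊φ·⌋-<-suc (suc ⌊ y /φ⌋) ⟩
  ⌊φ· suc (suc ⌊ y /φ⌋) ⌋         ≤⟨ ⌊φ·⌋-mono-≤ (≰⇒> ≰1+) ⟩
  ⌊φ· ⌊ suc y /φ⌋ ⌋               ∎))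
  where open ≤-Reasoning

⌊⌊φ·[1+k]⌋/φ⌋≡k : ∀ k → ⌊ ⌊φ· suc k ⌋ /φ⌋ ≡ k
⌊⌊φ·[1+k]⌋/φ⌋≡k k = ⌊/φ⌋-unique (⌊φ·⌋-<-suc k) ≤-refl

⌊[1+⌊φ·k⌋]/φ⌋≡k : ∀ k → ⌊ suc ⌊φ· k ⌋ /φ⌋ ≡ k
⌊[1+⌊φ·k⌋]/φ⌋≡k k = ⌊/φ⌋-unique ≤-refl (⌊φ·⌋-<-suc k)

Flat : (ℕ → ℕ) → ℕ → Set
Flat g n = g n ≡ g (suc n)

Jump : (ℕ → ℕ) → ℕ → Set
Jump g n = suc (g n) ≡ g (suc n)

Jump⇒¬Flat : ∀ {g n} → Jump g n → ¬ Flat g n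
Jump⇒¬Flat jump flat = 1+n≢n (trans jump (sym flat))

⌊1/φ⌋≡0 : ⌊ 1 /φ⌋ ≡ 0
⌊1/φ⌋≡0 = cong (_∸ 1) (proj₁ (proj₂ ⌊φ·⌋-values))

⌊2/φ⌋≡1 : ⌊ 2 /φ⌋ ≡ 1
⌊2/φ⌋≡1 = cong (_∸ 2) (proj₁ (proj₂ (proj₂ ⌊φ·⌋-values)))

⌊3/φ⌋≡1 : ⌊ 3 /φ⌋ ≡ 1
⌊3/φ⌋≡1 = cong (_∸ 3) (proj₁ (proj₂ (proj₂ (proj₂ ⌊φ·⌋-values))))

⌊4/φ⌋≡2 : ⌊ 4 /φ⌋ ≡ 2
⌊4/φ⌋≡2 = cong (_∸ 4) (proj₂ (proj₂ (proj₂ (proj₂ ⌊φ·⌋-values))))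

⌊/φ⌋-flat⊎jump : ∀ y → Flat ⌊_/φ⌋ y ⊎ Jump ⌊_/φ⌋ y
⌊/φ⌋-flat⊎jump y with m≤n⇒m<n∨m≡n (⌊/φ⌋-≤-suc y)
... | inj₂ flat = inj₁ flat
... | inj₁ <suc = inj₂ (≤-antisym <suc (⌊/φ⌋-suc-≤ y))

⌊φ·[1+q]⌋≡1+⌊φ·q⌋⇔Flat : ∀ q → ⌊φ· suc q ⌋ ≡ suc ⌊φ· q ⌋ ⇔ Flat ⌊_/φ⌋ q
⌊φ·[1+q]⌋≡1+⌊φ·q⌋⇔Flat q = mk⇔
  (λ eq → sym (+-cancelˡ-≡ q _ _ (suc-injective (trans (sym (⌊φ·⌋≡+⌊/φ⌋ (suc q))) (trans eq (cong suc (⌊φ·⌋≡+⌊/φ⌋ q)))))))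
  (λ flat → trans (⌊φ·⌋≡+⌊/φ⌋ (suc q)) (cong suc (trans (cong (q +_) (sym flat)) (sym (⌊φ·⌋≡+⌊/φ⌋ q)))))

⌊φ·[1+q]⌋≡2+⌊φ·q⌋ : ∀ {q} → Jump ⌊_/φ⌋ q → ⌊φ· suc q ⌋ ≡ suc (suc ⌊φ· q ⌋)
⌊φ·[1+q]⌋≡2+⌊φ·q⌋ {q} jump = begin
  ⌊φ· suc q ⌋                 ≡⟨ ⌊φ·⌋≡+⌊/φ⌋ (suc q) ⟩
  suc q + ⌊ suc q /φ⌋         ≡⟨ cong (suc q +_) jump ⟨
  suc q + suc ⌊ q /φ⌋         ≡⟨ cong suc (+-suc q ⌊ q /φ⌋) ⟩
  suc (suc (q + ⌊ q /φ⌋))     ≡⟨ cong (suc ∘ suc) (⌊φ·⌋≡+⌊/φ⌋ q) ⟨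
  suc (suc ⌊φ· q ⌋)           ∎
  where open ≡-Reasoning

⌊/φ⌋-Jump⇒≡⌊φ·⌋ : ∀ {m} → Jump ⌊_/φ⌋ m → m ≡ ⌊φ· ⌊ suc m /φ⌋ ⌋
⌊/φ⌋-Jump⇒≡⌊φ·⌋ {m} jump = ≤-antisym (subst (λ q → m ≤ ⌊φ· q ⌋) jump (n≤⌊φ·[1+⌊n/φ⌋]⌋ m)) (≤-pred (⌊φ·⌊n/φ⌋⌋<n (s≤s z≤n)))

⌊/φ⌋-Jump-at-⌊φ·⌋ : ∀ k → Jump ⌊_/φ⌋ ⌊φ· suc k ⌋
⌊/φ⌋-Jump-at-⌊φ·⌋ k = trans (cong suc (⌊⌊φ·[1+k]⌋/φ⌋≡k k)) (sym (⌊[1+⌊φ·k⌋]/φ⌋≡k (suc k)))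

⌊/φ⌋-Jump⇔ : ∀ {m} → Jump ⌊_/φ⌋ m ⇔ (∃[ k ] (1 ≤ k × m ≡ ⌊φ· k ⌋))
⌊/φ⌋-Jump⇔ {m} = mk⇔
  (λ jump → ⌊ suc m /φ⌋ , subst (1 ≤_) jump (s≤s z≤n) , ⌊/φ⌋-Jump⇒≡⌊φ·⌋ jump)
  (λ { (suc k , _ , refl) → ⌊/φ⌋-Jump-at-⌊φ·⌋ k })

⌊φ·⌊φ·[1+k]⌋⌋≡⌊φ·[1+k]⌋+k : ∀ k → ⌊φ· ⌊φ· suc k ⌋ ⌋ ≡ ⌊φ· suc k ⌋ + k
⌊φ·⌊φ·[1+k]⌋⌋≡⌊φ·[1+k]⌋+k k = trans (⌊φ·⌋≡+⌊/φ⌋ ⌊φ· suc k ⌋) (cong (⌊φ· suc k ⌋ +_) (⌊⌊φ·[1+k]⌋/φ⌋≡k k))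

⌊φ·[1+⌊φ·[1+k]⌋]⌋≡1+⌊φ·[1+k]⌋+[1+k] : ∀ k → ⌊φ· suc ⌊φ· suc k ⌋ ⌋ ≡ suc (⌊φ· suc k ⌋ + suc k)
⌊φ·[1+⌊φ·[1+k]⌋]⌋≡1+⌊φ·[1+k]⌋+[1+k] k = trans (⌊φ·⌋≡+⌊/φ⌋ (suc ⌊φ· suc k ⌋)) (cong (suc ∘ (⌊φ· suc k ⌋ +_)) (⌊[1+⌊φ·k⌋]/φ⌋≡k (suc k)))

⌊/φ⌋-Flat-at-⌊φ²·⌋ : ∀ k → Flat ⌊_/φ⌋ (⌊φ· suc k ⌋ + suc k)
⌊/φ⌋-Flat-at-⌊φ²·⌋ k = trans (⌊/φ⌋-unique lower (≤-trans (n≤1+n m) upper)) (sym (⌊/φ⌋-unique (<-trans lower (n<1+n m)) upper))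
  where
  p = ⌊φ· suc k ⌋
  m = p + suc k
  lower : ⌊φ· p ⌋ < m
  lower = subst (_< m) (sym (⌊φ·⌊φ·[1+k]⌋⌋≡⌊φ·[1+k]⌋+k k)) (+-monoʳ-< p (n<1+n k))
  upper : suc m ≤ ⌊φ· suc p ⌋
  upper = ≤-reflexive (sym (⌊φ·[1+⌊φ·[1+k]⌋]⌋≡1+⌊φ·[1+k]⌋+[1+k] k))

-- At a flat point m the interval of m has length 2, so ⌊ ·/φ⌋ jumps at its index q and m = ⌊φ q⌋ + 1.
⌊/φ⌋-Flat⇒≡⌊φ²·⌋ : ∀ {m} → 1 ≤ m → Flat ⌊_/φ⌋ m → ∃[ k ] (1 ≤ k × m ≡ ⌊φ· k ⌋ + k)
⌊/φ⌋-Flat⇒≡⌊φ²·⌋ {m} 1≤m flat = from-index (Equivalence.to ⌊/φ⌋-Jump⇔ jump-q)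
  where
  q = ⌊ m /φ⌋
  φq<m : ⌊φ· q ⌋ < m
  φq<m = ⌊φ·⌊n/φ⌋⌋<n 1≤m
  1+m≤φ[1+q] : suc m ≤ ⌊φ· suc q ⌋
  1+m≤φ[1+q] = subst (λ u → suc m ≤ ⌊φ· suc u ⌋) (sym flat) (n≤⌊φ·[1+⌊n/φ⌋]⌋ (suc m))
  jump-q : Jump ⌊_/φ⌋ q
  jump-q with ⌊/φ⌋-flat⊎jump q
  ... | inj₂ jump = jump
  ... | inj₁ flat-q = ⊥-elim (<-irrefl refl (≤-trans 1+m≤φ[1+q]
          (subst (_≤ m) (sym (Equivalence.from (⌊φ·[1+q]⌋≡1+⌊φ·q⌋⇔Flat q) flat-q)) φq<m)))
  m≡1+φq : m ≡ suc ⌊φ· q ⌋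
  m≡1+φq = ≤-antisym (≤-pred (subst (suc m ≤_) (⌊φ·[1+q]⌋≡2+⌊φ·q⌋ jump-q) 1+m≤φ[1+q])) φq<m
  from-index : ∃[ k ] (1 ≤ k × q ≡ ⌊φ· k ⌋) → ∃[ k ] (1 ≤ k × m ≡ ⌊φ· k ⌋ + k)
  from-index (suc k , 1≤k , q≡φk) = suc k , 1≤k , (begin
    m                           ≡⟨ m≡1+φq ⟩
    suc ⌊φ· q ⌋                 ≡⟨ cong (suc ∘ ⌊φ·_⌋) q≡φk ⟩
    suc ⌊φ· ⌊φ· suc k ⌋ ⌋       ≡⟨ cong suc (⌊φ·⌊φ·[1+k]⌋⌋≡⌊φ·[1+k]⌋+k k) ⟩
    suc (⌊φ· suc k ⌋ + k)       ≡⟨ +-suc ⌊φ· suc k ⌋ k ⟨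
    ⌊φ· suc k ⌋ + suc k         ∎)
    where open ≡-Reasoning

⌊/φ⌋-Flat⇔ : ∀ {m} → 1 ≤ m → Flat ⌊_/φ⌋ m ⇔ (∃[ k ] (1 ≤ k × m ≡ ⌊φ· k ⌋ + k))
⌊/φ⌋-Flat⇔ 1≤m = mk⇔ (⌊/φ⌋-Flat⇒≡⌊φ²·⌋ 1≤m) λ { (suc k , _ , refl) → ⌊/φ⌋-Flat-at-⌊φ²·⌋ k }

⌊/φ⌋-Jump²⇔ : ∀ {m} → (Jump ⌊_/φ⌋ m × Jump ⌊_/φ⌋ (suc m)) ⇔ (∃[ k ] (1 ≤ k × m ≡ ⌊φ· ⌊φ· k ⌋ + k ⌋))
⌊/φ⌋-Jump²⇔ {m} = mk⇔ to from
  where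
  to : Jump ⌊_/φ⌋ m × Jump ⌊_/φ⌋ (suc m) → ∃[ k ] (1 ≤ k × m ≡ ⌊φ· ⌊φ· k ⌋ + k ⌋)
  to (jump₁ , jump₂) = index-of-q (Equivalence.to (⌊/φ⌋-Flat⇔ (subst (1 ≤_) jump₁ (s≤s z≤n))) flat-q)
    where
    q = ⌊ suc m /φ⌋
    m≡φq : m ≡ ⌊φ· q ⌋
    m≡φq = ⌊/φ⌋-Jump⇒≡⌊φ·⌋ jump₁
    1+m≡φ[1+q] : suc m ≡ ⌊φ· suc q ⌋
    1+m≡φ[1+q] = trans (⌊/φ⌋-Jump⇒≡⌊φ·⌋ jump₂) (cong ⌊φ·_⌋ (sym jump₂))
    flat-q : Flat ⌊_/φ⌋ q
    flat-q = Equivalence.to (⌊φ·[1+q]⌋≡1+⌊φ·q⌋⇔Flat q) (trans (sym 1+m≡φ[1+q]) (cong suc m≡φq))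
    index-of-q : ∃[ k ] (1 ≤ k × q ≡ ⌊φ· k ⌋ + k) → ∃[ k ] (1 ≤ k × m ≡ ⌊φ· ⌊φ· k ⌋ + k ⌋)
    index-of-q (k , 1≤k , q≡) = k , 1≤k , trans m≡φq (cong ⌊φ·_⌋ q≡)
  from : ∃[ k ] (1 ≤ k × m ≡ ⌊φ· ⌊φ· k ⌋ + k ⌋) → Jump ⌊_/φ⌋ m × Jump ⌊_/φ⌋ (suc m)
  from (k , 1≤k , m≡φq) = Equivalence.from ⌊/φ⌋-Jump⇔ (q , 1≤q , m≡φq)
                        , Equivalence.from ⌊/φ⌋-Jump⇔ (suc q , s≤s z≤n , 1+m≡φ[1+q])
    where
    q = ⌊φ· k ⌋ + k
    1≤q : 1 ≤ q
    1≤q = ≤-trans 1≤k (m≤n+m k ⌊φ· k ⌋)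
    1+m≡φ[1+q] : suc m ≡ ⌊φ· suc q ⌋
    1+m≡φ[1+q] = trans (cong suc m≡φq) (sym (Equivalence.from (⌊φ·[1+q]⌋≡1+⌊φ·q⌋⇔Flat q)
                   (Equivalence.from (⌊/φ⌋-Flat⇔ 1≤q) (k , 1≤k , refl))))

fib-≤-suc : ∀ n → fib n ≤ fib (suc n)
fib-≤-suc zero = z≤n
fib-≤-suc (suc zero) = s≤s z≤n
fib-≤-suc (suc (suc n)) = m≤m+n _ _

fib-mono-≤ : ∀ {m n} → m ≤ n → fib m ≤ fib n
fib-mono-≤ = suc-mono-≤⇒mono-≤ fib fib-≤-suc

1≤fib[1+n] : ∀ n → 1 ≤ fib (suc n)
1≤fib[1+n] n = fib-mono-≤ {1} {suc n} (s≤s z≤n)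

-- ⌊ y /φ⌋ is additive over a Fibonacci shift because F₍ᵢ₊₃₎ / φ is within 1/F₍ᵢ₊₃₎ of F₍ᵢ₊₂₎.
FibShift : ℕ → Set
FibShift i = ∀ {x} → 1 ≤ x → x ≤ suc (fib (2 + i)) → ⌊ fib (3 + i) + x /φ⌋ ≡ fib (2 + i) + ⌊ x /φ⌋

FibShift-zero : FibShift 0
FibShift-zero {1} _ _ = trans ⌊3/φ⌋≡1 (cong suc (sym ⌊1/φ⌋≡0))
FibShift-zero {2} _ _ = trans ⌊4/φ⌋≡2 (cong suc (sym ⌊2/φ⌋≡1))
FibShift-zero {suc (suc (suc _))} _ (s≤s (s≤s ()))

module _ {i} (shift : FibShift i) where
  private
    F₂ = fib (2 + i)
    F₃ = fib (3 + i)
    F₄ = fib (4 + i)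

  FibShift⇒⌊φ·⌋-shift : ∀ {y} → 1 ≤ y → y ≤ suc F₂ → ⌊φ· F₃ + y ⌋ ≡ F₄ + ⌊φ· y ⌋
  FibShift⇒⌊φ·⌋-shift {y} 1≤y y≤1+F₂ = begin
    ⌊φ· F₃ + y ⌋                   ≡⟨ ⌊φ·⌋≡+⌊/φ⌋ (F₃ + y) ⟩
    (F₃ + y) + ⌊ F₃ + y /φ⌋        ≡⟨ cong ((F₃ + y) +_) (shift 1≤y y≤1+F₂) ⟩
    (F₃ + y) + (F₂ + ⌊ y /φ⌋)      ≡⟨ regroup F₃ y F₂ ⌊ y /φ⌋ ⟩
    F₄ + (y + ⌊ y /φ⌋)             ≡⟨ cong (F₄ +_) (⌊φ·⌋≡+⌊/φ⌋ y) ⟨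
    F₄ + ⌊φ· y ⌋                   ∎
    where
    open ≡-Reasoning
    regroup : ∀ a b c d → (a + b) + (c + d) ≡ (a + c) + (b + d)
    regroup = solve-∀

  FibShift⇒⌊F₃+1/φ⌋≡F₂ : ⌊ F₃ + 1 /φ⌋ ≡ F₂
  FibShift⇒⌊F₃+1/φ⌋≡F₂ = trans (shift (s≤s z≤n) (s≤s z≤n)) (trans (cong (F₂ +_) ⌊1/φ⌋≡0) (+-identityʳ F₂))

  FibShift⇒⌊φ·F₃⌋≤F₄ : ⌊φ· F₃ ⌋ ≤ F₄
  FibShift⇒⌊φ·F₃⌋≤F₄ = begin
    ⌊φ· F₃ ⌋            ≡⟨ ⌊φ·⌋≡+⌊/φ⌋ F₃ ⟩
    F₃ + ⌊ F₃ /φ⌋       ≤⟨ +-monoʳ-≤ F₃ (subst (⌊ F₃ /φ⌋ ≤_) FibShift⇒⌊F₃+1/φ⌋≡F₂ (⌊/φ⌋-mono-≤ (m≤m+n F₃ 1))) ⟩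
    F₄                  ∎
    where open ≤-Reasoning

  FibShift⇒⌊φ·⌋-shift-≤ : ∀ y → y ≤ suc F₂ → ⌊φ· F₃ + y ⌋ ≤ F₄ + ⌊φ· y ⌋
  FibShift⇒⌊φ·⌋-shift-≤ zero _ = subst₂ _≤_ (cong ⌊φ·_⌋ (sym (+-identityʳ F₃)))
                                         (sym (trans (cong (F₄ +_) (proj₁ ⌊φ·⌋-values)) (+-identityʳ F₄)))
                                         FibShift⇒⌊φ·F₃⌋≤F₄
  FibShift⇒⌊φ·⌋-shift-≤ (suc y) y≤F₂ = ≤-reflexive (FibShift⇒⌊φ·⌋-shift (s≤s z≤n) y≤F₂)

  FibShift-suc : FibShift (suc i)
  FibShift-suc {x} 1≤x x≤1+F₃ = ⌊/φ⌋-unique lower upper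
    where
    r = ⌊ x /φ⌋
    r≤F₂ : r ≤ F₂
    r≤F₂ = subst (r ≤_) FibShift⇒⌊F₃+1/φ⌋≡F₂ (⌊/φ⌋-mono-≤ (subst (x ≤_) (+-comm 1 F₃) x≤1+F₃))
    lower : ⌊φ· F₃ + r ⌋ < F₄ + x
    lower = ≤-<-trans (FibShift⇒⌊φ·⌋-shift-≤ r (m≤n⇒m≤1+n r≤F₂)) (+-monoʳ-< F₄ (⌊φ·⌊n/φ⌋⌋<n 1≤x))
    upper : F₄ + x ≤ ⌊φ· suc (F₃ + r) ⌋
    upper = subst (F₄ + x ≤_) (trans (sym (FibShift⇒⌊φ·⌋-shift (s≤s z≤n) (s≤s r≤F₂))) (cong ⌊φ·_⌋ (+-suc F₃ r)))
                  (+-monoʳ-≤ F₄ (n≤⌊φ·[1+⌊n/φ⌋]⌋ x))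

⌊/φ⌋-fib-shift : ∀ i → FibShift i
⌊/φ⌋-fib-shift zero = FibShift-zero
⌊/φ⌋-fib-shift (suc i) = FibShift-suc {i} (⌊/φ⌋-fib-shift i)

n≤1+fib[n] : ∀ n → n ≤ suc (fib n)
n≤1+fib[n] zero = z≤n
n≤1+fib[n] (suc zero) = s≤s z≤n
n≤1+fib[n] (suc (suc n)) = s≤s (step n (n≤1+fib[n] (suc n)))
  where
  step : ∀ n → suc n ≤ suc (fib (suc n)) → suc n ≤ fib (suc n) + fib n
  step zero _ = s≤s z≤n
  step (suc n) 1+n≤ = subst (suc (suc n) ≤_) (+-comm (fib (suc n)) (fib (suc (suc n))))
                        (+-mono-≤ (1≤fib[1+n] n) (≤-pred 1+n≤))

findJ-finds : ∀ d fuel i n → d ≤ fuel → fib (i + d) < n → n ≤ fib (suc (i + d)) → findJ fuel i n ≡ i + d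
findJ-finds zero zero i n _ _ _ = sym (+-identityʳ i)
findJ-finds zero (suc fuel) i n _ _ n≤ with n ≤? fib (suc i)
... | yes _ = sym (+-identityʳ i)
... | no n≰ = ⊥-elim (n≰ (subst (λ u → n ≤ fib (suc u)) (+-identityʳ i) n≤))
findJ-finds (suc d) (suc fuel) i n (s≤s d≤fuel) <n n≤ with n ≤? fib (suc i)
... | yes n≤′ = ⊥-elim (<⇒≱ <n (≤-trans n≤′ (fib-mono-≤ (subst (suc i ≤_) (sym (+-suc i d)) (s≤s (m≤m+n i d))))))
... | no _ = trans (findJ-finds d fuel (suc i) n d≤fuel (subst (λ u → fib u < n) (+-suc i d) <n) (subst (λ u → n ≤ fib (suc u)) (+-suc i d) n≤))
                   (sym (+-suc i d))

findJ-≥ : ∀ fuel i n → i ≤ findJ fuel i n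
findJ-≥ zero i n = ≤-refl
findJ-≥ (suc fuel) i n with n ≤? fib (suc i)
... | yes _ = ≤-refl
... | no _ = ≤-trans (n≤1+n i) (findJ-≥ fuel (suc i) n)

∸-<-self : ∀ {m n} → 1 ≤ m → 1 ≤ n → n ∸ m < n
∸-<-self {suc m} {suc n} _ _ = s≤s (m∸n≤m n m)

aFuel-irrelevant : ∀ f g n → n < f → n < g → aFuel f n ≡ aFuel g n
aFuel-irrelevant (suc f) (suc g) zero _ _ = refl
aFuel-irrelevant (suc f) (suc g) (suc zero) _ _ = refl
aFuel-irrelevant (suc f) (suc g) n@(suc (suc _)) (s≤s n≤f) (s≤s n≤g) =
  cong (fib (suc j) ∸_) (aFuel-irrelevant f g (n ∸ fib j) (<-≤-trans rest<n n≤f) (<-≤-trans rest<n n≤g))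
  where
  j = findJ n 2 n
  rest<n : n ∸ fib j < n
  rest<n = ∸-<-self (fib-mono-≤ (≤-trans (s≤s z≤n) (findJ-≥ n 2 n))) (s≤s z≤n)

a-recurrence : ∀ j n → 2 ≤ j → fib j < n → n ≤ fib (suc j) → a n ≡ fib (suc j) ∸ a (n ∸ fib j)
a-recurrence j zero _ () _
a-recurrence (suc j) (suc zero) _ 1<F _ = ⊥-elim (<⇒≱ 1<F (1≤fib[1+n] j))
a-recurrence j n@(suc (suc _)) 2≤j F<n n≤F = begin
    fib (suc (findJ n 2 n)) ∸ aFuel n (n ∸ fib (findJ n 2 n))   ≡⟨ cong (λ u → fib (suc u) ∸ aFuel n (n ∸ fib u)) findJ≡j ⟩
    fib (suc j) ∸ aFuel n (n ∸ fib j)                          ≡⟨ cong (fib (suc j) ∸_) (aFuel-irrelevant n (suc (n ∸ fib j)) (n ∸ fib j) rest<n ≤-refl) ⟩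
    fib (suc j) ∸ a (n ∸ fib j)                                ∎
  where
  open ≡-Reasoning
  2+[j∸2]≡j : 2 + (j ∸ 2) ≡ j
  2+[j∸2]≡j = m+[n∸m]≡n 2≤j
  findJ≡j : findJ n 2 n ≡ j
  findJ≡j = trans (findJ-finds (j ∸ 2) n 2 n (≤-trans (m∸n≤m j 2) (≤-trans (n≤1+fib[n] j) F<n))
                     (subst (λ u → fib u < n) (sym 2+[j∸2]≡j) F<n) (subst (λ u → n ≤ fib (suc u)) (sym 2+[j∸2]≡j) n≤F))
                  2+[j∸2]≡j
  rest<n : n ∸ fib j < n
  rest<n = ∸-<-self (fib-mono-≤ (≤-trans (s≤s z≤n) 2≤j)) (s≤s z≤n)

fib-block : ∀ n → 3 ≤ n → ∃[ i ] ∃[ m ] (1 ≤ m × m ≤ fib (2 + i) × n ≡ fib (3 + i) + m)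
fib-block 1 (s≤s ())
fib-block 2 (s≤s (s≤s ()))
fib-block 3 _ = 0 , 1 , ≤-refl , ≤-refl , refl
fib-block (suc n@(suc (suc (suc _)))) _ with fib-block n (s≤s (s≤s (s≤s z≤n)))
... | i , m , 1≤m , m≤F₂ , n≡F₃+m with m≤n⇒m<n∨m≡n m≤F₂
...   | inj₁ m<F₂ = i , suc m , s≤s z≤n , m<F₂ , trans (cong suc n≡F₃+m) (sym (+-suc (fib (3 + i)) m))
...   | inj₂ m≡F₂ = suc i , 1 , ≤-refl , 1≤fib[1+n] (2 + i)
                  , trans (cong suc (trans n≡F₃+m (cong (fib (3 + i) +_) m≡F₂))) (+-comm 1 (fib (4 + i)))

a≤2n : ∀ n → a n ≤ 2 * n
a≤2n 0 = z≤n
a≤2n 1 = s≤s z≤n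
a≤2n 2 = s≤s z≤n
a≤2n (suc (suc (suc k))) = in-block (s≤s (s≤s (s≤s z≤n)))
  where
  in-block : ∀ {n} → 3 ≤ n → a n ≤ 2 * n
  in-block {n} 3≤n with fib-block n 3≤n
  ... | i , m , 1≤m , m≤F₂ , refl = begin
    a n                  ≡⟨ a-recurrence (3 + i) n (s≤s (s≤s z≤n)) F₃<n n≤F₄ ⟩
    F₄ ∸ a (n ∸ F₃)      ≤⟨ m∸n≤m F₄ (a (n ∸ F₃)) ⟩
    F₃ + F₂              ≤⟨ +-monoʳ-≤ F₃ (≤-trans (fib-≤-suc (2 + i)) (m≤m+n F₃ 0)) ⟩
    2 * F₃               ≤⟨ *-monoʳ-≤ 2 (m≤m+n F₃ m) ⟩
    2 * n                ∎
    where
    open ≤-Reasoning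
    F₂ = fib (2 + i)
    F₃ = fib (3 + i)
    F₄ = fib (4 + i)
    F₃<n : F₃ < n
    F₃<n = subst (_≤ n) (+-comm F₃ 1) (+-monoʳ-≤ F₃ 1≤m)
    n≤F₄ : n ≤ F₄
    n≤F₄ = +-monoʳ-≤ F₃ m≤F₂

a-fib-shift : ∀ i {m} → 1 ≤ m → m ≤ fib (2 + i) → a (fib (3 + i) + m) ≡ fib (4 + i) ∸ a m
a-fib-shift i {m} 1≤m m≤F₂ = trans (a-recurrence (3 + i) (F₃ + m) (s≤s (s≤s z≤n)) F₃<F₃+m (+-monoʳ-≤ F₃ m≤F₂))
                                   (cong (λ u → fib (4 + i) ∸ a u) (m+n∸m≡n F₃ m))
  where
  F₃ = fib (3 + i)
  F₃<F₃+m : F₃ < F₃ + m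
  F₃<F₃+m = subst (_≤ F₃ + m) (+-comm F₃ 1) (+-monoʳ-≤ F₃ 1≤m)

a-Flat-fib-shift : ∀ i {m} → 1 ≤ m → suc m ≤ fib (2 + i) → Flat a (fib (3 + i) + m) ⇔ Flat a m
a-Flat-fib-shift i {m} 1≤m 1+m≤F₂ = mk⇔
  (λ flat → ∸-cancelˡ-≡ (a≤F₄ m≤F₂) (a≤F₄ 1+m≤F₂) (trans (sym a[F₃+m]) (trans flat a[1+F₃+m])))
  (λ flat → trans a[F₃+m] (trans (cong (F₄ ∸_) flat) (sym a[1+F₃+m])))
  where
  F₂ = fib (2 + i)
  F₃ = fib (3 + i)
  F₄ = fib (4 + i)
  m≤F₂ : m ≤ F₂
  m≤F₂ = ≤-trans (n≤1+n m) 1+m≤F₂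
  a≤F₄ : ∀ {x} → x ≤ F₂ → a x ≤ F₄
  a≤F₄ {x} x≤F₂ = ≤-trans (a≤2n x) (≤-trans (*-monoʳ-≤ 2 x≤F₂) (+-mono-≤ (fib-≤-suc (2 + i)) (≤-reflexive (+-identityʳ F₂))))
  a[F₃+m] : a (F₃ + m) ≡ F₄ ∸ a m
  a[F₃+m] = a-fib-shift i 1≤m m≤F₂
  a[1+F₃+m] : a (suc (F₃ + m)) ≡ F₄ ∸ a (suc m)
  a[1+F₃+m] = trans (cong a (sym (+-suc F₃ m))) (a-fib-shift i (s≤s z≤n) 1+m≤F₂)

⌊/φ⌋-Flat-fib-shift : ∀ i {m} → suc m ≤ fib (2 + i) → Flat ⌊_/φ⌋ (suc (fib (3 + i) + m)) ⇔ Flat ⌊_/φ⌋ (suc m)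
⌊/φ⌋-Flat-fib-shift i {m} 1+m≤F₂ = mk⇔
  (λ flat → +-cancelˡ-≡ F₂ _ _ (trans (sym shift₁) (trans flat shift₂)))
  (λ flat → trans shift₁ (trans (cong (F₂ +_) flat) (sym shift₂)))
  where
  F₂ = fib (2 + i)
  F₃ = fib (3 + i)
  shift₁ : ⌊ suc (F₃ + m) /φ⌋ ≡ F₂ + ⌊ suc m /φ⌋
  shift₁ = trans (cong ⌊_/φ⌋ (sym (+-suc F₃ m))) (⌊/φ⌋-fib-shift i (s≤s z≤n) (m≤n⇒m≤1+n 1+m≤F₂))
  shift₂ : ⌊ suc (suc (F₃ + m)) /φ⌋ ≡ F₂ + ⌊ suc (suc m) /φ⌋
  shift₂ = trans (cong ⌊_/φ⌋ (sym (trans (+-suc F₃ (suc m)) (cong suc (+-suc F₃ m))))) (⌊/φ⌋-fib-shift i (s≤s z≤n) (s≤s 1+m≤F₂))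

a-<-after-fib : ∀ i → a (fib (4 + i)) < a (suc (fib (4 + i)))
a-<-after-fib i = begin-strict
  a (F₃ + F₂)            ≡⟨ a-fib-shift i (1≤fib[1+n] (suc i)) ≤-refl ⟩
  F₄ ∸ a F₂              ≤⟨ m∸n≤m F₄ (a F₂) ⟩
  F₄                     <⟨ subst (_≤ F₄ + (F₃ ∸ 1)) (+-comm F₄ 1) (+-monoʳ-≤ F₄ (∸-monoˡ-≤ 1 2≤F₃)) ⟩
  F₄ + (F₃ ∸ 1)          ≡⟨ +-∸-assoc F₄ (1≤fib[1+n] (2 + i)) ⟨
  F₄ + F₃ ∸ a 1          ≡⟨ a-fib-shift (suc i) ≤-refl (1≤fib[1+n] (2 + i)) ⟨
  a (F₄ + 1)             ≡⟨ cong a (+-comm F₄ 1) ⟩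
  a (suc F₄)             ∎
  where
  open ≤-Reasoning
  F₂ = fib (2 + i)
  F₃ = fib (3 + i)
  F₄ = fib (4 + i)
  2≤F₃ : 2 ≤ F₃
  2≤F₃ = fib-mono-≤ {3} {3 + i} (s≤s (s≤s (s≤s z≤n)))

⌊/φ⌋-Jump-after-fib : ∀ i → Jump ⌊_/φ⌋ (suc (fib (4 + i)))
⌊/φ⌋-Jump-after-fib i = begin
  suc ⌊ suc F₄ /φ⌋             ≡⟨ cong (suc ∘ ⌊_/φ⌋) (+-comm 1 F₄) ⟩
  suc ⌊ F₄ + 1 /φ⌋             ≡⟨ cong suc (⌊/φ⌋-fib-shift (suc i) (s≤s z≤n) (s≤s z≤n)) ⟩
  suc (F₃ + ⌊ 1 /φ⌋)           ≡⟨ cong (λ u → suc (F₃ + u)) ⌊1/φ⌋≡0 ⟩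
  suc (F₃ + 0)                 ≡⟨ +-suc F₃ 0 ⟨
  F₃ + 1                       ≡⟨ cong (F₃ +_) ⌊2/φ⌋≡1 ⟨
  F₃ + ⌊ 2 /φ⌋                 ≡⟨ ⌊/φ⌋-fib-shift (suc i) (s≤s z≤n) (s≤s (1≤fib[1+n] (2 + i))) ⟨
  ⌊ F₄ + 2 /φ⌋                 ≡⟨ cong ⌊_/φ⌋ (+-comm F₄ 2) ⟩
  ⌊ suc (suc F₄) /φ⌋           ∎
  where
  open ≡-Reasoning
  F₃ = fib (3 + i)
  F₄ = fib (4 + i)

a-Flat⇔⌊/φ⌋-Flat : ∀ n → Flat a n ⇔ Flat ⌊_/φ⌋ (suc n)
a-Flat⇔⌊/φ⌋-Flat = <-rec P step
  where
  P : ℕ → Set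
  P n = Flat a n ⇔ Flat ⌊_/φ⌋ (suc n)
  in-block : ∀ {n} → 3 ≤ n → (∀ {m} → m < n → P m) → P n
  in-block {n} 3≤n rec with fib-block n 3≤n
  ... | i , m , 1≤m , m≤F₂ , refl with m≤n⇒m<n∨m≡n m≤F₂
  ...   | inj₁ 1+m≤F₂ = ⇔-trans (a-Flat-fib-shift i 1≤m 1+m≤F₂)
                          (⇔-trans (rec (m<n+m m (1≤fib[1+n] (2 + i)))) (⇔-sym (⌊/φ⌋-Flat-fib-shift i 1+m≤F₂)))
  ...   | inj₂ refl = mk⇔ (λ flat → ⊥-elim (<-irrefl flat (a-<-after-fib i)))
                          (λ flat → ⊥-elim (Jump⇒¬Flat {g = ⌊_/φ⌋} (⌊/φ⌋-Jump-after-fib i) flat))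
  step : ∀ n → (∀ {m} → m < n → P m) → P n
  step 0 _ = mk⇔ (λ ()) (λ flat → ⊥-elim (0≢1+n (trans (sym ⌊1/φ⌋≡0) (trans flat ⌊2/φ⌋≡1))))
  step 1 _ = mk⇔ (λ _ → trans ⌊2/φ⌋≡1 (sym ⌊3/φ⌋≡1)) (λ _ → refl)
  step 2 _ = mk⇔ (λ ()) (λ flat → ⊥-elim (1+n≢n (sym (trans (sym ⌊3/φ⌋≡1) (trans flat ⌊4/φ⌋≡2)))))
  step n@(suc (suc (suc _))) rec = in-block (s≤s (s≤s (s≤s z≤n))) rec

¬a-Flat⇔⌊/φ⌋-Jump : ∀ n → (¬ Flat a n) ⇔ Jump ⌊_/φ⌋ (suc n)
¬a-Flat⇔⌊/φ⌋-Jump n = mk⇔ to (λ jump flat → Jump⇒¬Flat {g = ⌊_/φ⌋} jump (Equivalence.to (a-Flat⇔⌊/φ⌋-Flat n) flat))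
  where
  to : ¬ Flat a n → Jump ⌊_/φ⌋ (suc n)
  to ¬flat with ⌊/φ⌋-flat⊎jump (suc n)
  ... | inj₁ flat = ⊥-elim (¬flat (Equivalence.from (a-Flat⇔⌊/φ⌋-Flat n) flat))
  ... | inj₂ jump = jump

floorPhi2≡⌊φ·⌋+k : ∀ k → floorPhi2 k ≡ ⌊φ· k ⌋ + k
floorPhi2≡⌊φ·⌋+k k = begin
  (3 * k + s) / 2          ≡⟨ cong (_/ 2) (regroup k s) ⟩
  (2 * k + (k + s)) / 2    ≡⟨ [2*k+n]/2≡k+n/2 k (k + s) ⟩
  k + floorPhi k           ≡⟨ +-comm k (floorPhi k) ⟩
  floorPhi k + k           ≡⟨ cong (_+ k) (⌊φ·⌋≡floorPhi k) ⟨
  ⌊φ· k ⌋ + k              ∎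
  where
  open ≡-Reasoning
  s = floorSqrt5 k
  regroup : ∀ k s → 3 * k + s ≡ 2 * k + (k + s)
  regroup = solve-∀

floorPhiPlusInvPhi≡⌊φ·[1+k]⌋∸1 : ∀ k → floorPhiPlusInvPhi k ≡ ⌊φ· suc k ⌋ ∸ 1
floorPhiPlusInvPhi≡⌊φ·[1+k]⌋∸1 k with floorSqrt5 (suc k) | 1≤isqrt {5 * (suc k * suc k)} (s≤s z≤n) | ⌊φ·⌋≡floorPhi (suc k)
... | zero | () | _
... | suc t | _ | φ≡ = begin
  (k + suc t ∸ 1) / 2          ≡⟨ cong (λ u → (u ∸ 1) / 2) (+-suc k t) ⟩
  (k + t) / 2                  ≡⟨ cong (_∸ 1) ([2+n]/2≡1+n/2 (k + t)) ⟨
  suc (suc (k + t)) / 2 ∸ 1    ≡⟨ cong (λ u → suc u / 2 ∸ 1) (+-suc k t) ⟨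
  (suc k + suc t) / 2 ∸ 1      ≡⟨ cong (_∸ 1) φ≡ ⟨
  ⌊φ· suc k ⌋ ∸ 1              ∎
  where open ≡-Reasoning

a-Flat⇔floorPhi2 : ∀ n → Flat a n ⇔ (∃[ k ] (1 ≤ k × n ≡ floorPhi2 k ∸ 1))
a-Flat⇔floorPhi2 n =
  ⇔-trans (a-Flat⇔⌊/φ⌋-Flat n)
  (⇔-trans (⌊/φ⌋-Flat⇔ (s≤s z≤n))
  (∃-⇔ λ k → ×-⇔ʳ λ 1≤k →
    ⇔-trans (suc-≡⇔≡-∸1 (≤-trans 1≤k (m≤n+m k ⌊φ· k ⌋))) (≡-trans-⇔ (cong (_∸ 1) (sym (floorPhi2≡⌊φ·⌋+k k))))))

¬a-Flat⇔floorPhiPlusInvPhi : ∀ n → (¬ Flat a n) ⇔ (∃[ k ] (n ≡ floorPhiPlusInvPhi k))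
¬a-Flat⇔floorPhiPlusInvPhi n =
  ⇔-trans (¬a-Flat⇔⌊/φ⌋-Jump n)
  (⇔-trans ⌊/φ⌋-Jump⇔
  (mk⇔ (λ { (suc k , _ , 1+n≡) → k , Equivalence.to (index-shift k) 1+n≡ })
       (λ (k , n≡) → suc k , s≤s z≤n , Equivalence.from (index-shift k) n≡)))
  where
  index-shift : ∀ k → (suc n ≡ ⌊φ· suc k ⌋) ⇔ (n ≡ floorPhiPlusInvPhi k)
  index-shift k = ⇔-trans (suc-≡⇔≡-∸1 (≤-trans (s≤s z≤n) (n≤⌊φ·n⌋ (suc k))))
                          (≡-trans-⇔ (sym (floorPhiPlusInvPhi≡⌊φ·[1+k]⌋∸1 k)))

a-isolated⇔floorPhi∘floorPhi2 : ∀ n →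
  ((a (suc n) ≢ a n × a (suc n) ≢ a (suc (suc n))) ⇔ (∃[ k ] (1 ≤ k × suc n ≡ floorPhi (floorPhi2 k))))
a-isolated⇔floorPhi∘floorPhi2 n =
  ⇔-trans (mk⇔ (λ (≢prev , ≢next) → to (¬a-Flat⇔⌊/φ⌋-Jump n) (≢prev ∘ sym) , to (¬a-Flat⇔⌊/φ⌋-Jump (suc n)) ≢next)
               (λ (jump₁ , jump₂) → from (¬a-Flat⇔⌊/φ⌋-Jump n) jump₁ ∘ sym , from (¬a-Flat⇔⌊/φ⌋-Jump (suc n)) jump₂))
  (⇔-trans ⌊/φ⌋-Jump²⇔
  (∃-⇔ λ k → ×-⇔ʳ λ _ →
    ≡-trans-⇔ (trans (⌊φ·⌋≡floorPhi (⌊φ· k ⌋ + k)) (cong floorPhi (sym (floorPhi2≡⌊φ·⌋+k k))))))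
  where open Equivalence

proposition9 : ((n : ℕ) → (a n ≡ a (suc n)) ⇔ (∃[ k ] (1 ≤ k × n ≡ floorPhi2 k ∸ 1)))
    × ((n : ℕ) → (a n ≢ a (suc n)) ⇔ (∃[ k ] (n ≡ floorPhiPlusInvPhi k)))
    × ((n : ℕ) → 1 ≤ n →
        ((a n ≢ a (n ∸ 1) × a n ≢ a (suc n))
          ⇔ (∃[ k ] (1 ≤ k × n ≡ floorPhi (floorPhi2 k)))))
proposition9 = a-Flat⇔floorPhi2 , ¬a-Flat⇔floorPhiPlusInvPhi , λ { (suc n) _ → a-isolated⇔floorPhi∘floorPhi2 n }
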